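{- Let $n,\lambda_0,\lambda_1$ be non-negative integers with $\lambda_0+\lambda_1=n$ and $\{\lambda_0,\lambda_1\}\cap\{0,n\}=\emptyset$. Then there does not exist a nonempty set $\{F_1,\dots,F_k\}$ of mutually orthogonal binary frequency squares of type $(n;\lambda_0,\lambda_1)$ whose sum $F_1+\cdots+F_k$ (ordinary matrix addition over $\mathbb{Z}$) is a constant matrix.
   Context: A binary frequency square of type $(n;\lambda_0,\lambda_1)$ is an $n\times n$ $(0,1)$-matrix with exactly $\lambda_0$ zeros and $\lambda_1$ ones in each row and column; two such squares are orthogonal if exactly $\lambda_1^2$ cells contain $1$ in both; mutually orthogonal means pairwise orthogonal. -}

module Defs where

open import Data.Nat using (ℕ; _*_)
open import Data.Bool using (Bool; true; false; _∧_)
open import Data.Fin using (Fin)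
open import Data.Vec.Functional using (Vector)
import Data.Nat.Base as N
import Data.Bool
import Data.Fin as Fin
open import Relation.Nullary.Decidable using (isYes)
open import Relation.Binary.PropositionalEquality using (_≡_)
open import Data.Product using (_×_)

-- an n × n (0,1)-matrix: 'true' stands for 1, 'false' for 0
BinMatrix : ℕ → Set
BinMatrix n = Fin n → Fin n → Bool

bit : Bool → ℕ
bit true  = 1
bit false = 0

sumFin : (n : ℕ) → (Fin n → ℕ) → ℕ
sumFin N.zero f = 0
sumFin (N.suc n) f = f Fin.zero N.+ sumFin n (λ i → f (Fin.suc i))

rowCount : ∀ {n} → BinMatrix n → Bool → Fin n → ℕ
rowCount {n} M b i = sumFin n (λ j → bit (isYes (M i j Data.Bool.≟ b)))

colCount : ∀ {n} → BinMatrix n → Bool → Fin n → ℕ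
colCount {n} M b j = rowCount {n} (λ x y → M y x) b j

IsBFS : (n l₀ l₁ : ℕ) → BinMatrix n → Set
IsBFS n l₀ l₁ M =
  (∀ i → rowCount M false i ≡ l₀ × rowCount M true i ≡ l₁) ×
  (∀ j → colCount M false j ≡ l₀ × colCount M true j ≡ l₁)

commonOnes : ∀ {n} → BinMatrix n → BinMatrix n → ℕ
commonOnes {n} F G = sumFin n (λ i → sumFin n (λ j → bit (F i j ∧ G i j)))

Orthogonal : (n l₁ : ℕ) → BinMatrix n → BinMatrix n → Set
Orthogonal n l₁ F G = commonOnes F G ≡ l₁ * l₁

-- entrywise integer sum F₁ + ⋯ + Fₖ (entries are non-negative, so ℕ suffices)
sumSquares : ∀ {n} k → (Fin k → BinMatrix n) → Fin n → Fin n → ℕ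
sumSquares k F i j = sumFin k (λ t → bit (F t i j))

{-# OPTIONS --safe #-}
module Submission where

-- Let F₀ be one of the squares and suppose their sum S is the constant c.
-- Counting the cells of F₀ weighted by S gives
--   c · n l₁ = Σ_t |F₀ ∩ F_t| = n l₁ + (k − 1) l₁²,
-- while the total of S gives n² c = k n l₁. Eliminating c leaves
-- n² l₁ = n l₁², so l₁ = n. Only the row sums of ones enter.

open import Defs
open import Data.Nat using (ℕ; zero; suc; _+_; _*_; _≥_; ≢-nonZero)
open import Data.Nat.Properties
  using (+-*-semiring; +-identityʳ; *-cancelˡ-≡; +-cancelʳ-≡; m*n≢0; m+n≡0⇒n≡0)
open import Data.Nat.Tactic.RingSolver using (solve)
open import Data.Bool using (true; false; _∧_; _≟_)
open import Data.Bool.Properties using (∧-idem)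
open import Data.Fin using (Fin; zero; suc)
open import Data.List using (_∷_; [])
open import Data.Product using (Σ; _,_; proj₂)
open import Function using (_∘_)
open import Function.Definitions using (Injective)
open import Relation.Binary.PropositionalEquality
  using (_≡_; _≢_; refl; sym; trans; cong; cong₂; module ≡-Reasoning)
open import Relation.Nullary using (¬_)
open import Relation.Nullary.Decidable using (isYes)
open import Algebra.Properties.Semiring.Sum +-*-semiring
  using (sum; sum-syntax; sum-cong-≗; ∑-comm; *-distribˡ-sum; *-distribʳ-sum)

open ≡-Reasoning

sumFin≡sum : ∀ n (f : Fin n → ℕ) → sumFin n f ≡ sum f
sumFin≡sum zero    f = refl
sumFin≡sum (suc n) f = cong (f zero +_) (sumFin≡sum n (f ∘ suc))

sumFin²≡∑∑ : ∀ m n (f : Fin m → Fin n → ℕ) →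
  sumFin m (λ i → sumFin n (f i)) ≡ ∑[ i < m ] ∑[ j < n ] f i j
sumFin²≡∑∑ m n f =
  trans (sumFin≡sum m (λ i → sumFin n (f i))) (sum-cong-≗ (sumFin≡sum n ∘ f))

∑∑-cong : ∀ {m n} {f g : Fin m → Fin n → ℕ} → (∀ i j → f i j ≡ g i j) →
  ∑[ i < m ] ∑[ j < n ] f i j ≡ ∑[ i < m ] ∑[ j < n ] g i j
∑∑-cong f≡g = sum-cong-≗ (sum-cong-≗ ∘ f≡g)

sum-const : ∀ n c → ∑[ i < n ] c ≡ n * c
sum-const zero    c = refl
sum-const (suc n) c = cong (c +_) (sum-const n c)

∑∑-const : ∀ {m n c} (S : Fin m → Fin n → ℕ) → (∀ i j → S i j ≡ c) →
  ∑[ i < m ] ∑[ j < n ] S i j ≡ m * (n * c)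
∑∑-const {m} {n} {c} S S≡c = begin
  ∑[ i < m ] ∑[ j < n ] S i j  ≡⟨ sum-cong-≗ (λ i → trans (sum-cong-≗ (S≡c i)) (sum-const n c)) ⟩
  ∑[ i < m ] (n * c)           ≡⟨ sum-const m (n * c) ⟩
  m * (n * c)                  ∎

∑∑-*-const : ∀ {m n c} (w S : Fin m → Fin n → ℕ) → (∀ i j → S i j ≡ c) →
  ∑[ i < m ] ∑[ j < n ] (w i j * S i j) ≡ (∑[ i < m ] ∑[ j < n ] w i j) * c
∑∑-*-const {m} {n} {c} w S S≡c = begin
  ∑[ i < m ] ∑[ j < n ] (w i j * S i j)  ≡⟨ ∑∑-cong (λ i j → cong (w i j *_) (S≡c i j)) ⟩
  ∑[ i < m ] ∑[ j < n ] (w i j * c)      ≡⟨ sum-cong-≗ (λ i → *-distribʳ-sum c (w i)) ⟨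
  ∑[ i < m ] ((∑[ j < n ] w i j) * c)    ≡⟨ *-distribʳ-sum c (λ i → ∑[ j < n ] w i j) ⟨
  (∑[ i < m ] ∑[ j < n ] w i j) * c      ∎

∑∑∑-comm : ∀ {m n k} (f : Fin m → Fin n → Fin k → ℕ) →
  ∑[ i < m ] ∑[ j < n ] ∑[ t < k ] f i j t ≡ ∑[ t < k ] ∑[ i < m ] ∑[ j < n ] f i j t
∑∑∑-comm {n = n} f =
  trans (sum-cong-≗ (λ i → ∑-comm (f i))) (∑-comm (λ i t → ∑[ j < n ] f i j t))

bit-isYes-≟true : ∀ b → bit (isYes (b ≟ true)) ≡ bit b
bit-isYes-≟true true  = refl
bit-isYes-≟true false = refl

bit-∧ : ∀ a b → bit (a ∧ b) ≡ bit a * bit b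
bit-∧ true  b = sym (+-identityʳ (bit b))
bit-∧ false b = refl

ones : ∀ {n} → BinMatrix n → ℕ
ones {n} M = ∑[ i < n ] ∑[ j < n ] bit (M i j)

rowCount-true : ∀ {n} (M : BinMatrix n) i → rowCount M true i ≡ ∑[ j < n ] bit (M i j)
rowCount-true {n} M i =
  trans (sumFin≡sum n (λ j → bit (isYes (M i j ≟ true))))
        (sum-cong-≗ (bit-isYes-≟true ∘ M i))

ones-BFS : ∀ {n l₀ l₁} (M : BinMatrix n) → IsBFS n l₀ l₁ M → ones M ≡ n * l₁
ones-BFS {n} {l₁ = l₁} M (rows , _) =
  trans (sum-cong-≗ (λ i → trans (sym (rowCount-true M i)) (proj₂ (rows i))))
        (sum-const n l₁)

commonOnes≡∑∑ : ∀ {n} (F G : BinMatrix n) →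
  commonOnes F G ≡ ∑[ i < n ] ∑[ j < n ] (bit (F i j) * bit (G i j))
commonOnes≡∑∑ {n} F G =
  trans (sumFin²≡∑∑ n n (λ i j → bit (F i j ∧ G i j)))
        (∑∑-cong (λ i j → bit-∧ (F i j) (G i j)))

commonOnes-self : ∀ {n} (M : BinMatrix n) → commonOnes M M ≡ ones M
commonOnes-self {n} M =
  trans (sumFin²≡∑∑ n n (λ i j → bit (M i j ∧ M i j)))
        (∑∑-cong (λ i j → cong bit (∧-idem (M i j))))

∑∑-sumSquares : ∀ {n} k (F : Fin k → BinMatrix n) →
  ∑[ i < n ] ∑[ j < n ] sumSquares k F i j ≡ ∑[ t < k ] ones (F t)
∑∑-sumSquares k F =
  trans (∑∑-cong (λ i j → sumFin≡sum k (λ t → bit (F t i j))))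
        (∑∑∑-comm (λ i j t → bit (F t i j)))

∑∑-weighted-sumSquares : ∀ {n} k (F : Fin k → BinMatrix n) (G : BinMatrix n) →
  ∑[ i < n ] ∑[ j < n ] (bit (G i j) * sumSquares k F i j) ≡ ∑[ t < k ] commonOnes G (F t)
∑∑-weighted-sumSquares {n} k F G = begin
  ∑[ i < n ] ∑[ j < n ] (bit (G i j) * sumSquares k F i j)
    ≡⟨ ∑∑-cong (λ i j → cong (bit (G i j) *_) (sumFin≡sum k (λ t → bit (F t i j)))) ⟩
  ∑[ i < n ] ∑[ j < n ] (bit (G i j) * ∑[ t < k ] bit (F t i j))
    ≡⟨ ∑∑-cong (λ i j → *-distribˡ-sum (bit (G i j)) (λ t → bit (F t i j))) ⟩
  ∑[ i < n ] ∑[ j < n ] ∑[ t < k ] (bit (G i j) * bit (F t i j))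
    ≡⟨ ∑∑∑-comm (λ i j t → bit (G i j) * bit (F t i j)) ⟩
  ∑[ t < k ] ∑[ i < n ] ∑[ j < n ] (bit (G i j) * bit (F t i j))
    ≡⟨ sum-cong-≗ (commonOnes≡∑∑ G ∘ F) ⟨
  ∑[ t < k ] commonOnes G (F t) ∎

∑-commonOnes-orthogonal : ∀ {n l₀ l₁} k (F : Fin (suc k) → BinMatrix n) →
  IsBFS n l₀ l₁ (F zero) →
  ((t : Fin k) → Orthogonal n l₁ (F zero) (F (suc t))) →
  ∑[ t < suc k ] commonOnes (F zero) (F t) ≡ n * l₁ + k * (l₁ * l₁)
∑-commonOnes-orthogonal {l₁ = l₁} k F bfs orth = cong₂ _+_
  (trans (commonOnes-self (F zero)) (ones-BFS (F zero) bfs))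
  (trans (sum-cong-≗ orth) (sum-const k (l₁ * l₁)))

counting-identities⇒≡ : ∀ {n l c k} → n ≢ 0 → l ≢ 0 →
  n * l * c ≡ n * l + k * (l * l) → n * (n * c) ≡ suc k * (n * l) → n ≡ l
counting-identities⇒≡ {n} {l} {c} {k} n≢0 l≢0 weighted total =
  *-cancelˡ-≡ n l (n * l) {{m*n≢0 n l {{≢-nonZero n≢0}} {{≢-nonZero l≢0}}}}
    (+-cancelʳ-≡ (n * (k * (l * l))) _ _ eq)
  where
  eq : n * l * n + n * (k * (l * l)) ≡ n * l * l + n * (k * (l * l))
  eq = begin
    n * l * n + n * (k * (l * l))  ≡⟨ solve (n ∷ l ∷ k ∷ []) ⟩
    n * (n * l + k * (l * l))      ≡⟨ cong (n *_) weighted ⟨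
    n * (n * l * c)                ≡⟨ solve (n ∷ l ∷ c ∷ []) ⟩
    n * (n * c) * l                ≡⟨ cong (_* l) total ⟩
    suc k * (n * l) * l            ≡⟨ solve (n ∷ l ∷ k ∷ []) ⟩
    n * l * l + n * (k * (l * l))  ∎

theorem3p5 : (n l₀ l₁ : ℕ) → l₀ + l₁ ≡ n →
    l₀ ≢ 0 → l₀ ≢ n → l₁ ≢ 0 → l₁ ≢ n →
    (k : ℕ) → k ≥ 1 → (F : Fin k → BinMatrix n) →
    Injective _≡_ _≡_ F →
    ((t : Fin k) → IsBFS n l₀ l₁ (F t)) →
    ((s t : Fin k) → ¬ (s ≡ t) → Orthogonal n l₁ (F s) (F t)) →
    ¬ (Σ ℕ (λ c → (i j : Fin n) → sumSquares k F i j ≡ c))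
theorem3p5 n l₀ l₁ l₀+l₁≡n _ _ l₁≢0 l₁≢n (suc k) _ F _ bfs orth (c , S≡c) =
  l₁≢n (sym (counting-identities⇒≡ {k = k} n≢0 l₁≢0 weighted total))
  where
  S = sumSquares (suc k) F

  n≢0 : n ≢ 0
  n≢0 n≡0 = l₁≢0 (m+n≡0⇒n≡0 l₀ (trans l₀+l₁≡n n≡0))

  weighted : n * l₁ * c ≡ n * l₁ + k * (l₁ * l₁)
  weighted = begin
    n * l₁ * c
      ≡⟨ cong (_* c) (ones-BFS (F zero) (bfs zero)) ⟨
    ones (F zero) * c
      ≡⟨ ∑∑-*-const (λ i j → bit (F zero i j)) S S≡c ⟨
    ∑[ i < n ] ∑[ j < n ] (bit (F zero i j) * S i j)
      ≡⟨ ∑∑-weighted-sumSquares (suc k) F (F zero) ⟩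
    ∑[ t < suc k ] commonOnes (F zero) (F t)
      ≡⟨ ∑-commonOnes-orthogonal k F (bfs zero) (λ t → orth zero (suc t) λ ()) ⟩
    n * l₁ + k * (l₁ * l₁) ∎

  total : n * (n * c) ≡ suc k * (n * l₁)
  total = begin
    n * (n * c)                    ≡⟨ ∑∑-const S S≡c ⟨
    ∑[ i < n ] ∑[ j < n ] S i j    ≡⟨ ∑∑-sumSquares (suc k) F ⟩
    ∑[ t < suc k ] ones (F t)      ≡⟨ sum-cong-≗ (λ t → ones-BFS (F t) (bfs t)) ⟩
    ∑[ t < suc k ] (n * l₁)        ≡⟨ sum-const (suc k) (n * l₁) ⟩
    suc k * (n * l₁)               ∎
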